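{- Let $G$ be a graph in $\mathcal{R}_{UVR}$. Then $G$ is a Roman graph. Moreover, if $f=(V_0^f;V_1^f;V_2^f)$ is any $\gamma_R$-function on $G$, then $V_1^f=\emptyset$, $V_2^f$ is a $\gamma$-set of $G$, and $|pn[v,V_2^f]|\ge 3$ for every $v\in V_2^f$. Finally, if $D$ is any $\gamma$-set of $G$, then $h=(V(G)-D;\emptyset;D)$ is a $\gamma_R$-function on $G$.
   Context: All graphs are finite, simple and undirected. A Roman dominating function (RDF) on $G$ is a map $f:V(G)\to\{0,1,2\}$ such that every vertex with $f$-value $0$ has a neighbor with $f$-value $2$; writing $V_i^f=\{v: f(v)=i\}$, we identify $f$ with the triple $(V_0^f;V_1^f;V_2^f)$. The weight of $f$ is $|V_1^f|+2|V_2^f|$, $\gamma_R(G)$ is the minimum weight of an RDF, and a $\gamma_R$-function is an RDF of weight $\gamma_R(G)$. A dominating set is a set $D\subseteq V(G)$ such that every vertex not in $D$ has a neighbor in $D$; $\gamma(G)$ is the minimum size of a dominating set, and a $\gamma$-set is a dominating set of size $\gamma(G)$. $G$ is Roman if $\gamma_R(G)=2\gamma(G)$. $\mathcal{R}_{UVR}$ is the class of graphs $G$ with $\gamma_R(G-v)=\gamma_R(G)$ for all $v\in V(G)$. For $x\in X\subseteq V(G)$, the $X$-private neighborhood of $x$ is $pn[x,X]=\{y\in V(G): N[y]\cap X=\{x\}\}$, where $N[y]$ is the closed neighborhood of $y$. -}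

module Defs where

open import Data.Nat using (ℕ; _+_; _*_; _≤_)
open import Data.Fin using (Fin; punchIn)
open import Data.Fin.Subset using (Subset; ∣_∣; _∈_; _∉_)
open import Data.Vec using (tabulate; lookup)
open import Data.Bool using (Bool; true; false; if_then_else_)
open import Data.Product using (Σ; _×_; ∃; ∃-syntax)
open import Data.Sum using (_⊎_)
open import Relation.Binary.PropositionalEquality using (_≡_; _≢_)

record Graph (n : ℕ) : Set where
  field
    adj    : Fin n → Fin n → Bool
    sym    : ∀ u v → adj u v ≡ adj v u
    irrefl : ∀ v → adj v v ≡ false
open Graph public

Adj : ∀ {n} → Graph n → Fin n → Fin n → Set
Adj G u v = adj G u v ≡ true

delete : ∀ {n} → Graph (Data.Nat.suc n) → Fin (Data.Nat.suc n) → Graph n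
delete G v = record
  { adj    = λ i j → adj G (punchIn v i) (punchIn v j)
  ; sym    = λ i j → sym G (punchIn v i) (punchIn v j)
  ; irrefl = λ i → irrefl G (punchIn v i)
  }

data RV : Set where
  r0 r1 r2 : RV

isR1 : RV → Bool
isR1 r1 = true
isR1 _  = false

isR2 : RV → Bool
isR2 r2 = true
isR2 _  = false

RFun : ℕ → Set
RFun n = Fin n → RV

V₁ : ∀ {n} → RFun n → Subset n
V₁ f = tabulate (λ v → isR1 (f v))

V₂ : ∀ {n} → RFun n → Subset n
V₂ f = tabulate (λ v → isR2 (f v))

weight : ∀ {n} → RFun n → ℕ
weight f = ∣ V₁ f ∣ + 2 * ∣ V₂ f ∣

IsRDF : ∀ {n} → Graph n → RFun n → Set
IsRDF G f = ∀ v → f v ≡ r0 → ∃[ u ] (Adj G v u × f u ≡ r2)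

IsγRFunction : ∀ {n} → Graph n → RFun n → Set
IsγRFunction G f = IsRDF G f × (∀ g → IsRDF G g → weight f ≤ weight g)

IsγR : ∀ {n} → Graph n → ℕ → Set
IsγR G k = (∃[ f ] (IsRDF G f × weight f ≡ k)) × (∀ g → IsRDF G g → k ≤ weight g)

IsDominating : ∀ {n} → Graph n → Subset n → Set
IsDominating G D = ∀ v → v ∉ D → ∃[ u ] (Adj G v u × u ∈ D)

IsγSet : ∀ {n} → Graph n → Subset n → Set
IsγSet G D = IsDominating G D × (∀ D' → IsDominating G D' → ∣ D ∣ ≤ ∣ D' ∣)

Isγ : ∀ {n} → Graph n → ℕ → Set
Isγ G k = (∃[ D ] (IsDominating G D × ∣ D ∣ ≡ k)) × (∀ D → IsDominating G D → k ≤ ∣ D ∣)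

IsRoman : ∀ {n} → Graph n → Set
IsRoman G = ∀ a b → IsγR G a → Isγ G b → a ≡ 2 * b

InRUVR : ∀ {n} → Graph n → Set
InRUVR {ℕ.zero} G = Data.Unit.⊤
  where import Data.Unit
InRUVR {ℕ.suc n} G = ∀ v k → IsγR G k → IsγR (delete G v) k

InClosedNbr : ∀ {n} → Graph n → Fin n → Fin n → Set
InClosedNbr G y z = z ≡ y ⊎ Adj G y z

InPN : ∀ {n} → Graph n → Subset n → Fin n → Fin n → Set
InPN G X x y = InClosedNbr G y x × (∀ z → InClosedNbr G y z → z ∈ X → z ≡ x)

PN≥3 : ∀ {n} → Graph n → Subset n → Fin n → Set
PN≥3 G X x = ∃[ a ] ∃[ b ] ∃[ c ]
  (a ≢ b × a ≢ c × b ≢ c × InPN G X x a × InPN G X x b × InPN G X x c)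

fromDom : ∀ {n} → Subset n → RFun n
fromDom D v = if lookup D v then r2 else r0

-- Let f be a γ_R-function of G. If f v = 1, then f restricted to G - v is an RDF of weight
-- γ_R(G) - 1 < γ_R(G - v); hence V₁ f = ∅, V₂ f dominates G and γ_R(G) = 2 ∣V₂ f∣. Comparing f
-- with the RDF (V - D; ∅; D) of a dominating set D gives ∣V₂ f∣ ≤ ∣D∣, so γ_R = 2γ, V₂ f is a
-- γ-set and every γ-set D makes (V - D; ∅; D) a γ_R-function. Finally, for v ∈ V₂ f, trading the
-- 2 on v for a 1 on each vertex of pn[v, V₂ f] yields an RDF of weight γ_R - 2 + ∣pn[v, V₂ f]∣.
-- If ∣pn[v, V₂ f]∣ ≤ 2 it is again a γ_R-function, so ∣pn[v, V₂ f]∣ = 2 and it takes the value 1,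
-- which the first step rules out.
module Submission where

open import Defs hiding (sym)
open import Data.Nat using (ℕ; zero; suc; _+_; _*_; _≤_; _<_; z≤n; s≤s; s≤s⁻¹; _<?_)
open import Data.Nat.Properties
  using ( ≤-refl; ≤-trans; ≤-antisym; <⇒≤; ≮⇒≥; ≰⇒>; 1+n≰n; m≤m+n; m≤n+m
        ; +-mono-≤; +-monoˡ-≤; +-monoʳ-≤; +-cancelˡ-≤; +-cancelʳ-≤; *-monoʳ-≤; *-cancelˡ-≤
        ; +-0-commutativeMonoid; module ≤-Reasoning)
open import Data.Nat.Tactic.RingSolver using (solve-∀)
open import Algebra.Properties.CommutativeMonoid.Sum +-0-commutativeMonoid
  using (sum; sum-remove; ∑-distrib-+)
open import Data.Fin using (Fin; zero; suc; punchIn; punchOut; _≟_)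
open import Data.Fin.Properties using (all?; any?; punchInᵢ≢i; punchIn-injective; punchIn-punchOut)
open import Data.Fin.Subset using (Subset; ∣_∣; _∈_; ⊥)
open import Data.Fin.Subset.Properties using (_∈?_; anySubset?; Empty-unique; ∣⊥∣≡0)
open import Data.Vec using (tabulate; lookup)
open import Data.Vec.Properties using (lookup∘tabulate; tabulate-cong; tabulate∘lookup; []=⇒lookup; lookup⇒[]=)
open import Data.Bool using (Bool; true; false; T; if_then_else_)
import Data.Bool as Bool
open import Data.Unit using (tt)
open import Data.Product using (_×_; ∃; ∃-syntax; _,_; proj₁; proj₂)
open import Data.Sum using (inj₁; inj₂)
open import Data.Empty using (⊥-elim)
open import Function using (_∘_; case_of_)
open import Relation.Nullary using (¬_; Dec; yes; no)
open import Relation.Nullary.Decidable using (⌊_⌋; map′; decidable-stable; _⊎-dec_; _×-dec_; _→-dec_; ¬?)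
open import Relation.Binary using (DecidableEquality)
open import Relation.Binary.PropositionalEquality

private variable n : ℕ

∑-mono-≤ : {g h : Fin n → ℕ} → (∀ i → g i ≤ h i) → sum g ≤ sum h
∑-mono-≤ {zero} _ = z≤n
∑-mono-≤ {suc n} g≤h = +-mono-≤ (g≤h zero) (∑-mono-≤ (g≤h ∘ suc))

count : (Fin n → Bool) → ℕ
count p = sum (λ i → if p i then 1 else 0)

count>0⇒∃ : (p : Fin n → Bool) → 0 < count p → ∃[ a ] T (p a)
count>0⇒∃ {suc n} p pos with p zero in eq
... | true = zero , subst T (sym eq) tt
... | false = let a , pa = count>0⇒∃ (p ∘ suc) pos in suc a , pa

count-remove : (p : Fin (suc n) → Bool) {a : Fin (suc n)} → T (p a) →
  count p ≡ suc (count (p ∘ punchIn a))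
count-remove p {a} pa with p a | sum-remove {i = a} (λ i → if p i then 1 else 0)
... | true | eq = eq

count>k⇒∃-rest : ∀ {k} (p : Fin (suc n) → Bool) → suc k ≤ count p →
  ∃[ a ] (T (p a) × k ≤ count (p ∘ punchIn a))
count>k⇒∃-rest {k = k} p k<count with count>0⇒∃ p (≤-trans (s≤s z≤n) k<count)
... | a , pa = a , pa , s≤s⁻¹ (subst (suc k ≤_) (count-remove p pa) k<count)

two-distinct : (p : Fin n → Bool) → 2 ≤ count p →
  ∃[ a ] ∃[ b ] (a ≢ b × T (p a) × T (p b))
two-distinct {suc n} p 2≤count with count>k⇒∃-rest p 2≤count
... | a , pa , 1≤rest with count>0⇒∃ (p ∘ punchIn a) 1≤rest
... | b , pb = a , punchIn a b , punchInᵢ≢i a b ∘ sym , pa , pb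

three-distinct : (p : Fin n → Bool) → 3 ≤ count p →
  ∃[ a ] ∃[ b ] ∃[ c ] (a ≢ b × a ≢ c × b ≢ c × T (p a) × T (p b) × T (p c))
three-distinct {suc n} p 3≤count with count>k⇒∃-rest p 3≤count
... | a , pa , 2≤rest with two-distinct (p ∘ punchIn a) 2≤rest
... | b , c , b≢c , pb , pc =
  a , punchIn a b , punchIn a c ,
  punchInᵢ≢i a b ∘ sym , punchInᵢ≢i a c ∘ sym , b≢c ∘ punchIn-injective a b c ,
  pa , pb , pc

_≟ᵣ_ : DecidableEquality RV
r0 ≟ᵣ r0 = yes refl
r0 ≟ᵣ r1 = no λ ()
r0 ≟ᵣ r2 = no λ ()
r1 ≟ᵣ r0 = no λ ()
r1 ≟ᵣ r1 = yes refl
r1 ≟ᵣ r2 = no λ ()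
r2 ≟ᵣ r0 = no λ ()
r2 ≟ᵣ r1 = no λ ()
r2 ≟ᵣ r2 = yes refl

val : RV → ℕ
val r0 = 0
val r1 = 1
val r2 = 2

weight≡∑val : (f : RFun n) → weight f ≡ sum (val ∘ f)
weight≡∑val {zero} f = refl
weight≡∑val {suc n} f with f zero | weight≡∑val (f ∘ suc)
... | r0 | ih = ih
... | r1 | ih = cong suc ih
... | r2 | ih = trans (two-more ∣ V₁ (f ∘ suc) ∣ ∣ V₂ (f ∘ suc) ∣) (cong (2 +_) ih)
  where
  two-more : ∀ a b → a + 2 * suc b ≡ 2 + (a + 2 * b)
  two-more = solve-∀

weight-remove : (f : RFun (suc n)) (v : Fin (suc n)) → weight f ≡ val (f v) + weight (f ∘ punchIn v)
weight-remove f v = begin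
  weight f                                ≡⟨ weight≡∑val f ⟩
  sum (val ∘ f)                           ≡⟨ sum-remove (val ∘ f) ⟩
  val (f v) + sum (val ∘ f ∘ punchIn v)   ≡⟨ cong (val (f v) +_) (weight≡∑val (f ∘ punchIn v)) ⟨
  val (f v) + weight (f ∘ punchIn v)      ∎
  where open ≡-Reasoning

weight-cong : {f g : RFun n} → (∀ i → f i ≡ g i) → weight f ≡ weight g
weight-cong f≗g = cong₂ (λ A B → ∣ A ∣ + 2 * ∣ B ∣)
  (tabulate-cong (cong isR1 ∘ f≗g)) (tabulate-cong (cong isR2 ∘ f≗g))

∈tabulate⁻ : {p : Fin n → Bool} {i : Fin n} → i ∈ tabulate p → p i ≡ true
∈tabulate⁻ {p = p} {i} i∈ = trans (sym (lookup∘tabulate p i)) ([]=⇒lookup i∈)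

∈tabulate⁺ : {p : Fin n → Bool} {i : Fin n} → p i ≡ true → i ∈ tabulate p
∈tabulate⁺ {p = p} {i} pi = lookup⇒[]= i (tabulate p) (trans (lookup∘tabulate p i) pi)

∈V₂⁻ : {f : RFun n} {v : Fin n} → v ∈ V₂ f → f v ≡ r2
∈V₂⁻ {f = f} {v} v∈ with f v | ∈tabulate⁻ {p = isR2 ∘ f} v∈
... | r2 | _ = refl

∈V₂⁺ : {f : RFun n} {v : Fin n} → f v ≡ r2 → v ∈ V₂ f
∈V₂⁺ fv = ∈tabulate⁺ (cong isR2 fv)

≢r1⇒V₁≡⊥ : {f : RFun n} → (∀ v → f v ≢ r1) → V₁ f ≡ ⊥
≢r1⇒V₁≡⊥ {f = f} no-r1 = Empty-unique λ (v , v∈) → no-r1 v (isR1⇒r1 (∈tabulate⁻ {p = isR1 ∘ f} v∈))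
  where
  isR1⇒r1 : ∀ {x} → isR1 x ≡ true → x ≡ r1
  isR1⇒r1 {r1} _ = refl

V₁≡⊥⇒weight≡2∣V₂∣ : {f : RFun n} → V₁ f ≡ ⊥ → weight f ≡ 2 * ∣ V₂ f ∣
V₁≡⊥⇒weight≡2∣V₂∣ {n} {f} V₁≡⊥ = cong (_+ 2 * ∣ V₂ f ∣) (trans (cong ∣_∣ V₁≡⊥) (∣⊥∣≡0 n))

fromDom-≢r1 : (D : Subset n) → ∀ v → fromDom D v ≢ r1
fromDom-≢r1 D v with lookup D v
... | true = λ ()
... | false = λ ()

V₂-fromDom : (D : Subset n) → V₂ (fromDom D) ≡ D
V₂-fromDom D = trans (tabulate-cong isR2∘fromDom) (tabulate∘lookup D)
  where
  isR2∘fromDom : ∀ v → isR2 (fromDom D v) ≡ lookup D v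
  isR2∘fromDom v with lookup D v
  ... | true = refl
  ... | false = refl

weight-fromDom : (D : Subset n) → weight (fromDom D) ≡ 2 * ∣ D ∣
weight-fromDom D = trans (V₁≡⊥⇒weight≡2∣V₂∣ (≢r1⇒V₁≡⊥ (fromDom-≢r1 D))) (cong (λ A → 2 * ∣ A ∣) (V₂-fromDom D))

module _ {A : Set} (P : A → Set) (m : A → ℕ) (cheaper? : ∀ k → Dec (∃[ x ] (P x × m x < k))) where

  ∃-minimal-below : ∀ x → P x → ∃[ y ] (P y × m y ≤ m x × ∀ z → P z → m y ≤ m z)
  ∃-minimal-below x px = descend (m x) x px ≤-refl
    where
    descend : ∀ bound x → P x → m x ≤ bound → ∃[ y ] (P y × m y ≤ m x × ∀ z → P z → m y ≤ m z)
    descend bound x px _ with cheaper? (m x)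
    descend bound x px _ | no none = x , px , ≤-refl , λ z pz → ≮⇒≥ λ mz<mx → none (z , pz , mz<mx)
    descend zero x px mx≤0 | yes (y , py , my<mx) = case ≤-trans my<mx mx≤0 of λ ()
    descend (suc bound) x px mx≤ | yes (y , py , my<mx) =
      let z , pz , mz≤my , minimal = descend bound y py (s≤s⁻¹ (≤-trans my<mx mx≤))
      in z , pz , ≤-trans mz≤my (<⇒≤ my<mx) , minimal

-- Every Roman function is fromSubsets (V₁ f) (V₂ f), so pairs of subsets exhaust them.
fromSubsets : Subset n → Subset n → RFun n
fromSubsets A B v = if lookup B v then r2 else if lookup A v then r1 else r0

fromSubsets-V₁-V₂ : (f : RFun n) → ∀ v → fromSubsets (V₁ f) (V₂ f) v ≡ f v
fromSubsets-V₁-V₂ f v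
  rewrite lookup∘tabulate (isR1 ∘ f) v | lookup∘tabulate (isR2 ∘ f) v with f v
... | r0 = refl
... | r1 = refl
... | r2 = refl

module _ (G : Graph n) where

  IsRDF-cong : {f g : RFun n} → (∀ v → f v ≡ g v) → IsRDF G f → IsRDF G g
  IsRDF-cong f≗g rdf v gv with rdf v (trans (f≗g v) gv)
  ... | u , vu , fu = u , vu , trans (sym (f≗g u)) fu

  isRDF? : ∀ f → Dec (IsRDF G f)
  isRDF? f = all? λ v → f v ≟ᵣ r0 →-dec any? λ u → (adj G v u Bool.≟ true) ×-dec (f u ≟ᵣ r2)

  cheaperRDF? : ∀ k → Dec (∃[ f ] (IsRDF G f × weight f < k))
  cheaperRDF? k = map′
    (λ (A , B , found) → fromSubsets A B , found)
    (λ (f , rdf , f<k) → V₁ f , V₂ f ,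
      IsRDF-cong (sym ∘ fromSubsets-V₁-V₂ f) rdf ,
      subst (_< k) (sym (weight-cong (fromSubsets-V₁-V₂ f))) f<k)
    (anySubset? λ A → anySubset? λ B → isRDF? (fromSubsets A B) ×-dec (weight (fromSubsets A B) <? k))

  ∃γR-function-below : ∀ g → IsRDF G g → ∃[ f ] (IsγRFunction G f × weight f ≤ weight g)
  ∃γR-function-below g rdf with ∃-minimal-below (IsRDF G) weight cheaperRDF? g rdf
  ... | f , rf , f≤g , minimal = f , (rf , minimal) , f≤g

  fromDom-RDF : {D : Subset n} → IsDominating G D → IsRDF G (fromDom D)
  fromDom-RDF {D} dom v fromDom≡r0 with lookup D v in v∈?
  ... | false with dom v (λ v∈D → case (trans (sym ([]=⇒lookup v∈D)) v∈?) of λ ())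
  ...   | u , vu , u∈D = u , vu , cong (if_then r2 else r0) ([]=⇒lookup u∈D)

  ≢r1⇒V₂-dominating : {f : RFun n} → IsRDF G f → (∀ v → f v ≢ r1) → IsDominating G (V₂ f)
  ≢r1⇒V₂-dominating {f} rdf no-r1 v v∉V₂ with f v in fv
  ... | r0 = let u , vu , fu = rdf v fv in u , vu , ∈V₂⁺ fu
  ... | r1 = ⊥-elim (no-r1 v fv)
  ... | r2 = ⊥-elim (v∉V₂ (∈V₂⁺ fv))

restrict-RDF : (G : Graph (suc n)) {f : RFun (suc n)} (v : Fin (suc n)) →
  IsRDF G f → f v ≢ r2 → IsRDF (delete G v) (f ∘ punchIn v)
restrict-RDF G {f} v rdf fv≢r2 i fi with rdf (punchIn v i) fi
... | u , iu , fu = punchOut v≢u ,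
  subst (Adj G (punchIn v i)) (sym (punchIn-punchOut v≢u)) iu ,
  subst (λ w → f w ≡ r2) (sym (punchIn-punchOut v≢u)) fu
  where
  v≢u : v ≢ u
  v≢u refl = fv≢r2 fu

γR-function⇒γR : {G : Graph n} {f : RFun n} → IsγRFunction G f → IsγR G (weight f)
γR-function⇒γR (rdf , minimal) = (_ , rdf , refl) , minimal

γR-function⇒≢r1 : {G : Graph n} → InRUVR G → {f : RFun n} → IsγRFunction G f → ∀ v → f v ≢ r1
γR-function⇒≢r1 {suc n} {G} uvr {f} fγ@(rdf , _) v fv =
  1+n≰n (begin
    suc (weight (f ∘ punchIn v))          ≡⟨ cong (_+ weight (f ∘ punchIn v)) (cong val fv) ⟨
    val (f v) + weight (f ∘ punchIn v)    ≡⟨ weight-remove f v ⟨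
    weight f                              ≤⟨ proj₂ (uvr v _ (γR-function⇒γR {G = G} fγ)) _ restricted ⟩
    weight (f ∘ punchIn v)                ∎)
  where
  open ≤-Reasoning
  restricted : IsRDF (delete G v) (f ∘ punchIn v)
  restricted = restrict-RDF G v rdf λ fv≡r2 → case trans (sym fv) fv≡r2 of λ ()

module _ {G : Graph n} (uvr : InRUVR G) {f : RFun n} (fγ : IsγRFunction G f) where

  γR-function⇒V₁≡⊥ : V₁ f ≡ ⊥
  γR-function⇒V₁≡⊥ = ≢r1⇒V₁≡⊥ (γR-function⇒≢r1 uvr fγ)

  γR-function⇒weight≡2∣V₂∣ : weight f ≡ 2 * ∣ V₂ f ∣
  γR-function⇒weight≡2∣V₂∣ = V₁≡⊥⇒weight≡2∣V₂∣ γR-function⇒V₁≡⊥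

  γR-function⇒V₂-dominating : IsDominating G (V₂ f)
  γR-function⇒V₂-dominating = ≢r1⇒V₂-dominating G (proj₁ fγ) (γR-function⇒≢r1 uvr fγ)

  ∣V₂∣≤dominating : ∀ D → IsDominating G D → ∣ V₂ f ∣ ≤ ∣ D ∣
  ∣V₂∣≤dominating D dom = *-cancelˡ-≤ 2 (begin
    2 * ∣ V₂ f ∣          ≡⟨ γR-function⇒weight≡2∣V₂∣ ⟨
    weight f              ≤⟨ proj₂ fγ _ (fromDom-RDF G dom) ⟩
    weight (fromDom D)    ≡⟨ weight-fromDom D ⟩
    2 * ∣ D ∣             ∎)
    where open ≤-Reasoning

  γR-function⇒V₂-γSet : IsγSet G (V₂ f)
  γR-function⇒V₂-γSet = γR-function⇒V₂-dominating , ∣V₂∣≤dominating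

module _ (G : Graph n) where

  InClosedNbr? : ∀ y z → Dec (InClosedNbr G y z)
  InClosedNbr? y z = (z ≟ y) ⊎-dec (adj G y z Bool.≟ true)

  InPN? : ∀ X x y → Dec (InPN G X x y)
  InPN? X x y = InClosedNbr? y x ×-dec all? λ z → InClosedNbr? y z →-dec (z ∈? X →-dec z ≟ x)

  ¬InPN⇒another : ∀ {X x y} → InClosedNbr G y x → ¬ InPN G X x y →
    ∃[ z ] (InClosedNbr G y z × z ∈ X × z ≢ x)
  ¬InPN⇒another {X} {x} {y} yx ¬pn with any? (λ z → InClosedNbr? y z ×-dec z ∈? X ×-dec ¬? (z ≟ x))
  ... | yes found = found
  ... | no none = ⊥-elim (¬pn (yx , λ z yz z∈X →
          decidable-stable (z ≟ x) λ z≢x → none (z , yz , z∈X , z≢x)))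

module _ (G : Graph (suc n)) (f : RFun (suc n)) (v : Fin (suc n)) where

  isPrivateNbr : Fin (suc n) → Bool
  isPrivateNbr y = ⌊ InPN? G (V₂ f) v y ⌋

  -- v loses its 2, and every vertex of pn[v, V₂ f] (possibly v itself) gets a 1.
  privateShift : RFun (suc n)
  privateShift y = if isPrivateNbr y then r1 else if ⌊ y ≟ v ⌋ then r0 else f y

  privateShift-r2 : ∀ {z} → z ∈ V₂ f → z ≢ v → privateShift z ≡ r2
  privateShift-r2 {z} z∈V₂ z≢v with InPN? G (V₂ f) v z | z ≟ v
  ... | yes (_ , private-z) | _ = ⊥-elim (z≢v (private-z z (inj₁ refl) z∈V₂))
  ... | no _ | yes z≡v = ⊥-elim (z≢v z≡v)
  ... | no _ | no _ = ∈V₂⁻ {f = f} z∈V₂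

  privateShift-r1 : ∀ {y} → T (isPrivateNbr y) → privateShift y ≡ r1
  privateShift-r1 {y} pn-y with InPN? G (V₂ f) v y
  ... | yes _ = refl

  private
    another-r2-neighbour : ∀ {y} → ¬ InPN G (V₂ f) v y → InClosedNbr G y v → (y ∈ V₂ f → y ≡ v) →
      ∃[ z ] (Adj G y z × privateShift z ≡ r2)
    another-r2-neighbour ¬pn yv y∈V₂⇒y≡v with ¬InPN⇒another G yv ¬pn
    ... | z , inj₁ refl , z∈V₂ , z≢v = ⊥-elim (z≢v (y∈V₂⇒y≡v z∈V₂))
    ... | z , inj₂ yz , z∈V₂ , z≢v = z , yz , privateShift-r2 z∈V₂ z≢v

  privateShift-RDF : IsRDF G f → IsRDF G privateShift
  privateShift-RDF rdf y shift≡r0 with InPN? G (V₂ f) v y | y ≟ v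
  ... | no ¬pn | yes refl = another-r2-neighbour ¬pn (inj₁ refl) λ _ → refl
  ... | no ¬pn | no y≢v with rdf y shift≡r0
  ...   | u , yu , fu with u ≟ v
  ...     | no u≢v = u , yu , privateShift-r2 (∈V₂⁺ {f = f} fu) u≢v
  ...     | yes refl = another-r2-neighbour ¬pn (inj₂ yu) λ y∈V₂ →
              case trans (sym shift≡r0) (∈V₂⁻ {f = f} y∈V₂) of λ ()

  privateShift-weight : f v ≡ r2 → weight privateShift + 2 ≤ weight f + count isPrivateNbr
  privateShift-weight fv = begin
    weight privateShift + 2                                     ≡⟨ cong (_+ 2) (weight≡∑val privateShift) ⟩
    sum (val ∘ privateShift) + 2                                ≡⟨ cong (_+ 2) (sum-remove (val ∘ privateShift)) ⟩
    val (privateShift v) + sum (val ∘ privateShift ∘ punchIn v) + 2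
      ≡⟨ +-rearrange (val (privateShift v)) _ 2 ⟩
    val (privateShift v) + 2 + sum (val ∘ privateShift ∘ punchIn v)
      ≤⟨ +-mono-≤ shift-at-v (∑-mono-≤ (shift-≤ ∘ punchIn v)) ⟩
    bound v + sum (bound ∘ punchIn v)                           ≡⟨ sum-remove bound ⟨
    sum bound                                                   ≡⟨ ∑-distrib-+ (val ∘ f) (λ y → if isPrivateNbr y then 1 else 0) ⟩
    sum (val ∘ f) + count isPrivateNbr                                    ≡⟨ cong (_+ count isPrivateNbr) (weight≡∑val f) ⟨
    weight f + count isPrivateNbr                                         ∎
    where
    open ≤-Reasoning
    bound : Fin (suc n) → ℕ
    bound y = val (f y) + (if isPrivateNbr y then 1 else 0)
    +-rearrange : ∀ a b c → a + b + c ≡ a + c + b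
    +-rearrange = solve-∀
    shift-≤ : ∀ y → val (privateShift y) ≤ bound y
    shift-≤ y with InPN? G (V₂ f) v y | y ≟ v
    ... | yes _ | _ = m≤n+m 1 (val (f y))
    ... | no _ | yes _ = z≤n
    ... | no _ | no _ = m≤m+n (val (f y)) 0
    shift-at-v : val (privateShift v) + 2 ≤ bound v
    shift-at-v with InPN? G (V₂ f) v v
    ... | yes _ rewrite fv = ≤-refl
    ... | no _ with v ≟ v
    ...   | yes _ rewrite fv = ≤-refl
    ...   | no v≢v = ⊥-elim (v≢v refl)

  γR-function⇒3≤∣pn∣ : InRUVR G → IsγRFunction G f → f v ≡ r2 → 3 ≤ count isPrivateNbr
  γR-function⇒3≤∣pn∣ uvr fγ@(rdf , minimal) fv = ≰⇒> λ ∣pn∣≤2 →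
    let f≤shift : weight f ≤ weight privateShift
        f≤shift = minimal _ (privateShift-RDF rdf)
        shift≤f : weight privateShift ≤ weight f
        shift≤f = +-cancelʳ-≤ 2 _ _ (≤-trans (privateShift-weight fv) (+-monoʳ-≤ (weight f) ∣pn∣≤2))
        shiftγ : IsγRFunction G privateShift
        shiftγ = privateShift-RDF rdf , λ g rg → ≤-trans shift≤f (minimal g rg)
        2≤∣pn∣ : 2 ≤ count isPrivateNbr
        2≤∣pn∣ = +-cancelˡ-≤ (weight f) _ _ (≤-trans (+-monoˡ-≤ 2 f≤shift) (privateShift-weight fv))
        y , pn-y = count>0⇒∃ isPrivateNbr (≤-trans (s≤s z≤n) 2≤∣pn∣)
    in γR-function⇒≢r1 {G = G} uvr shiftγ y (privateShift-r1 pn-y)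

  γR-function⇒PN≥3 : InRUVR G → IsγRFunction G f → f v ≡ r2 → PN≥3 G (V₂ f) v
  γR-function⇒PN≥3 uvr fγ fv =
    let a , b , c , a≢b , a≢c , b≢c , pn-a , pn-b , pn-c = three-distinct isPrivateNbr (γR-function⇒3≤∣pn∣ uvr fγ fv)
    in a , b , c , a≢b , a≢c , b≢c , witness pn-a , witness pn-b , witness pn-c
    where
    witness : ∀ {y} → T (isPrivateNbr y) → InPN G (V₂ f) v y
    witness {y} pn-y with InPN? G (V₂ f) v y
    ... | yes private-y = private-y

UVR⇒Roman : {G : Graph n} → InRUVR G → IsRoman G
UVR⇒Roman {G = G} uvr a b ((f , rdf , f≡a) , minimalR) ((D , dom , ∣D∣≡b) , minimalD) = begin
  a                ≡⟨ f≡a ⟨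
  weight f         ≡⟨ γR-function⇒weight≡2∣V₂∣ uvr fγ ⟩
  2 * ∣ V₂ f ∣     ≡⟨ cong (2 *_) ∣V₂∣≡b ⟩
  2 * b            ∎
  where
  open ≡-Reasoning
  fγ : IsγRFunction G f
  fγ = rdf , λ g rg → subst (_≤ weight g) (sym f≡a) (minimalR g rg)
  ∣V₂∣≡b : ∣ V₂ f ∣ ≡ b
  ∣V₂∣≡b = ≤-antisym (subst (_ ≤_) ∣D∣≡b (∣V₂∣≤dominating uvr fγ D dom))
                     (minimalD _ (γR-function⇒V₂-dominating uvr fγ))

UVR⇒fromDom-γR-function : {G : Graph n} → InRUVR G → ∀ {D} → IsγSet G D → IsγRFunction G (fromDom D)
UVR⇒fromDom-γR-function {G = G} uvr {D} (dom , minimal) = fromDom-RDF G dom , λ g rdf →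
  let f , fγ , f≤g = ∃γR-function-below G g rdf in begin
    weight (fromDom D)   ≡⟨ weight-fromDom D ⟩
    2 * ∣ D ∣            ≤⟨ *-monoʳ-≤ 2 (minimal _ (γR-function⇒V₂-dominating uvr fγ)) ⟩
    2 * ∣ V₂ f ∣         ≡⟨ γR-function⇒weight≡2∣V₂∣ uvr fγ ⟨
    weight f             ≤⟨ f≤g ⟩
    weight g             ∎
  where open ≤-Reasoning

UVR⇒private≥3 : {G : Graph n} → InRUVR G → ∀ {f} → IsγRFunction G f → ∀ v → v ∈ V₂ f → PN≥3 G (V₂ f) v
UVR⇒private≥3 {suc n} {G} uvr {f} fγ v v∈V₂ = γR-function⇒PN≥3 G f v uvr fγ (∈V₂⁻ {f = f} v∈V₂)

mainTheorem2 : ∀ {n} (G : Graph n) → InRUVR G →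
    IsRoman G
    × (∀ f → IsγRFunction G f →
         V₁ f ≡ ⊥ × IsγSet G (V₂ f) × (∀ v → v ∈ V₂ f → PN≥3 G (V₂ f) v))
    × (∀ D → IsγSet G D → IsγRFunction G (fromDom D))
mainTheorem2 G uvr =
  UVR⇒Roman uvr ,
  (λ f fγ → γR-function⇒V₁≡⊥ uvr fγ , γR-function⇒V₂-γSet uvr fγ , UVR⇒private≥3 uvr fγ) ,
  λ D → UVR⇒fromDom-γR-function uvr
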